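{- Let $(\delta,K_1,K_2,C_0,C_1)$ be admissible parameters satisfying Case III with $C'>C+1$, where $C=\min(C_0,C_1)$, $C'=\max(C_0,C_1)$. Let $\mathbf C$ be a cycle with distances $d_0,d_1,d_2,x_1,\dots,x_k$ such that either $\mathbf C$ has even perimeter and $d_0+d_1+d_2>(C_0-1)+\sum_{i=1}^kx_i$, or $\mathbf C$ has odd perimeter and $d_0+d_1+d_2>(C_1-1)+\sum_{i=1}^kx_i$. Then $d_i\ge K_2$ for every $i\in\{0,1,2\}$ and $\sum_{i=1}^k x_i\le K_1$.
   Context: A $\delta$-edge-labelled cycle is a cycle graph (at least 3 vertices) with edge labels in $\{1,\dots,\delta\}$; it "has distances $d_1,\dots,d_m$" if its edges can be listed in some (arbitrary) order with these labels; its perimeter is the sum of labels. Parameters: integers with $3\le\delta<\infty$, $1\le K_1\le K_2\le\delta$, $2\delta+2\le C_0,C_1\le3\delta+2$, $C_0$ even, $C_1$ odd. Case III (admissible) means: $C>2\delta+K_1$, $K_1+2K_2\ge2\delta-1$, $3K_2\ge2\delta$, if $K_1+2K_2=2\delta-1$ then $C\ge2\delta+K_1+2$, and if $C'>C+1$ then $C\ge2\delta+K_2$. -}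

module Defs where

open import Data.Nat using (ℕ; _+_; _*_; _≤_; _<_; _⊔_; _⊓_)
open import Data.Nat.Divisibility using (_∣_)
open import Data.List using (List; _∷_; length)
open import Data.Nat.ListAction using (sum)
open import Data.List.Relation.Unary.All using (All)
open import Data.List.Relation.Binary.Permutation.Propositional using (_↭_)
open import Data.Product using (_×_)
open import Relation.Nullary using (¬_)

Even : ℕ → Set
Even n = 2 ∣ n

Odd : ℕ → Set
Odd n = ¬ (2 ∣ n)

-- A δ-edge-labelled cycle: a cycle graph on ≥ 3 vertices, represented (up to
-- isomorphism) by the cyclic sequence of its edge labels, each in {1,…,δ}.
record LabelledCycle (δ : ℕ) : Set where
  field
    labels    : List ℕ
    atLeast3  : 3 ≤ length labels
    inRange   : All (λ d → 1 ≤ d × d ≤ δ) labels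
open LabelledCycle public

HasDistances : ∀ {δ} → LabelledCycle δ → List ℕ → Set
HasDistances c ds = labels c ↭ ds

perimeter : ∀ {δ} → LabelledCycle δ → ℕ
perimeter c = sum (labels c)

Admissible : ℕ → ℕ → ℕ → ℕ → ℕ → Set
Admissible δ K₁ K₂ C₀ C₁ =
  3 ≤ δ × 1 ≤ K₁ × K₁ ≤ K₂ × K₂ ≤ δ ×
  2 * δ + 2 ≤ C₀ × C₀ ≤ 3 * δ + 2 ×
  2 * δ + 2 ≤ C₁ × C₁ ≤ 3 * δ + 2 ×
  Even C₀ × Odd C₁

CaseIII : ℕ → ℕ → ℕ → ℕ → ℕ → Set
CaseIII δ K₁ K₂ C₀ C₁ =
  2 * δ + K₁ < C ×
  2 * δ ≤ K₁ + 2 * K₂ + 1 ×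
  2 * δ ≤ 3 * K₂ ×
  (K₁ + 2 * K₂ + 1 ≡ 2 * δ → 2 * δ + K₁ + 2 ≤ C) ×
  (C + 1 < C' → 2 * δ + K₂ ≤ C)
  where
    open import Relation.Binary.PropositionalEquality using (_≡_)
    C  = C₀ ⊓ C₁
    C' = C₀ ⊔ C₁

module Submission where

open import Defs
open import Data.Nat using (ℕ; zero; suc; _+_; _*_; _∸_; _≤_; _<_; _⊔_; _⊓_; z≤n; s≤s)
open import Data.Nat.Properties
open import Data.Nat.Tactic.RingSolver using (solve-∀)
open import Data.List using (List; _∷_)
open import Data.List.Relation.Unary.All using (_∷_)
open import Data.List.Relation.Binary.Permutation.Propositional.Properties using (All-resp-↭)
open import Data.Nat.ListAction using (sum)
open import Data.Product using (_×_; _,_; proj₁; proj₂)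
open import Data.Sum using (_⊎_; inj₁; inj₂)
open import Relation.Binary.PropositionalEquality using (_≡_; cong)

-- Since every distance is at most δ, C ≥ 2δ + K₂ forces each dᵢ ≥ K₂ + Σxᵢ;
-- in particular K₂ + Σxᵢ ≤ δ, and 2δ ≤ K₁ + 2K₂ + 1 then gives 2Σxᵢ ≤ K₁ + 1.

pred+<⇒+≤ : ∀ {m n o} → 1 ≤ m → m ∸ 1 + n < o → m + n ≤ o
pred+<⇒+≤ {suc _} _ m+n≤o = m+n≤o

+≤⇒≤ˡ : ∀ {a b c δ t} → b ≤ δ → c ≤ δ → 2 * δ + t ≤ a + b + c → t ≤ a
+≤⇒≤ˡ {a} {b} {c} {δ} {t} b≤δ c≤δ 2δ+t≤a+b+c = +-cancelʳ-≤ (2 * δ) t a (begin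
  t + 2 * δ          ≡⟨ +-comm t (2 * δ) ⟩
  2 * δ + t          ≤⟨ 2δ+t≤a+b+c ⟩
  a + b + c          ≡⟨ +-assoc a b c ⟩
  a + (b + c)        ≤⟨ +-monoʳ-≤ a (+-mono-≤ b≤δ c≤δ) ⟩
  a + (δ + δ)        ≡⟨ cong (a +_) (δ+δ≡2*δ δ) ⟩
  a + 2 * δ          ∎)
  where
  open ≤-Reasoning
  δ+δ≡2*δ : ∀ δ → δ + δ ≡ 2 * δ
  δ+δ≡2*δ = solve-∀

+≤⇒≤-each₃ : ∀ {a b c δ t} → a ≤ δ → b ≤ δ → c ≤ δ → 2 * δ + t ≤ a + b + c →
  t ≤ a × t ≤ b × t ≤ c
+≤⇒≤-each₃ {a} {b} {c} a≤δ b≤δ c≤δ bound =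
  +≤⇒≤ˡ b≤δ c≤δ bound ,
  +≤⇒≤ˡ a≤δ c≤δ (≤-trans bound (≤-reflexive (swap₁₂ a b c))) ,
  +≤⇒≤ˡ a≤δ b≤δ (≤-trans bound (≤-reflexive (rotate a b c)))
  where
  swap₁₂ : ∀ a b c → a + b + c ≡ b + a + c
  swap₁₂ = solve-∀
  rotate : ∀ a b c → a + b + c ≡ c + a + b
  rotate = solve-∀

n+n≤1+m⇒n≤m : ∀ {m} n → n + n ≤ suc m → n ≤ m
n+n≤1+m⇒n≤m zero    _             = z≤n
n+n≤1+m⇒n≤m (suc n) (s≤s n+1+n≤m) = ≤-trans (m≤n+m (suc n) n) n+1+n≤m

K₂+s≤δ⇒s≤K₁ : ∀ {δ K₁ K₂ s} → K₂ + s ≤ δ → 2 * δ ≤ K₁ + 2 * K₂ + 1 → s ≤ K₁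
K₂+s≤δ⇒s≤K₁ {δ} {K₁} {K₂} {s} K₂+s≤δ 2δ≤K₁+2K₂+1 =
  n+n≤1+m⇒n≤m s (+-cancelʳ-≤ (2 * K₂) (s + s) (suc K₁) (begin
    s + s + 2 * K₂    ≡⟨ double-+ K₂ s ⟩
    2 * (K₂ + s)      ≤⟨ *-monoʳ-≤ 2 K₂+s≤δ ⟩
    2 * δ             ≤⟨ 2δ≤K₁+2K₂+1 ⟩
    K₁ + 2 * K₂ + 1   ≡⟨ +-suc-last K₁ K₂ ⟩
    suc K₁ + 2 * K₂   ∎))
  where
  open ≤-Reasoning
  double-+ : ∀ k s → s + s + 2 * k ≡ 2 * (k + s)
  double-+ = solve-∀
  +-suc-last : ∀ m k → m + 2 * k + 1 ≡ suc m + 2 * k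
  +-suc-last = solve-∀

longSide⇒2δ+K₂+s≤D : ∀ {δ K₁ K₂ C₀ C₁ P s D} → Admissible δ K₁ K₂ C₀ C₁ → CaseIII δ K₁ K₂ C₀ C₁ →
  (C₀ ⊓ C₁) + 1 < C₀ ⊔ C₁ →
  (Even P × C₀ ∸ 1 + s < D) ⊎ (Odd P × C₁ ∸ 1 + s < D) →
  2 * δ + (K₂ + s) ≤ D
longSide⇒2δ+K₂+s≤D {δ} {K₂ = K₂} {C₀} {C₁} {s = s} {D} (_ , _ , _ , _ , C₀≥ , _ , C₁≥ , _) (_ , _ , _ , _ , C≥-if-gap)
  gap long-side = begin
    2 * δ + (K₂ + s)   ≡⟨ +-assoc (2 * δ) K₂ s ⟨
    2 * δ + K₂ + s     ≤⟨ +-monoˡ-≤ s (C≥-if-gap gap) ⟩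
    C₀ ⊓ C₁ + s        ≤⟨ C+s≤D long-side ⟩
    D                  ∎
  where
  open ≤-Reasoning
  C+s≤D-via : ∀ {Cⱼ} → 2 * δ + 2 ≤ Cⱼ → C₀ ⊓ C₁ ≤ Cⱼ → Cⱼ ∸ 1 + s < D → C₀ ⊓ C₁ + s ≤ D
  C+s≤D-via Cⱼ≥ C≤Cⱼ lt =
    ≤-trans (+-monoˡ-≤ s C≤Cⱼ) (pred+<⇒+≤ (≤-trans (s≤s z≤n) (≤-trans (m≤n+m 2 (2 * δ)) Cⱼ≥)) lt)
  C+s≤D : ∀ {P} → (Even P × C₀ ∸ 1 + s < D) ⊎ (Odd P × C₁ ∸ 1 + s < D) → C₀ ⊓ C₁ + s ≤ D
  C+s≤D (inj₁ (_ , lt)) = C+s≤D-via C₀≥ (m⊓n≤m C₀ C₁) lt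
  C+s≤D (inj₂ (_ , lt)) = C+s≤D-via C₁≥ (m⊓n≤n C₀ C₁) lt

mainTheorem11 : (δ K₁ K₂ C₀ C₁ : ℕ) → Admissible δ K₁ K₂ C₀ C₁ → CaseIII δ K₁ K₂ C₀ C₁ →
    (C₀ ⊓ C₁) + 1 < C₀ ⊔ C₁ →
    (c : LabelledCycle δ) (d₀ d₁ d₂ : ℕ) (xs : List ℕ) →
    HasDistances c (d₀ ∷ d₁ ∷ d₂ ∷ xs) →
    (Even (perimeter c) × (C₀ ∸ 1) + sum xs < d₀ + d₁ + d₂)
    ⊎ (Odd (perimeter c) × (C₁ ∸ 1) + sum xs < d₀ + d₁ + d₂) →
    (K₂ ≤ d₀ × K₂ ≤ d₁ × K₂ ≤ d₂) × sum xs ≤ K₁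
mainTheorem11 δ K₁ K₂ C₀ C₁ adm caseIII gap c d₀ d₁ d₂ xs c↭ds long-side
  with All-resp-↭ c↭ds (inRange c)
... | (_ , d₀≤δ) ∷ (_ , d₁≤δ) ∷ (_ , d₂≤δ) ∷ _
  with +≤⇒≤-each₃ d₀≤δ d₁≤δ d₂≤δ (longSide⇒2δ+K₂+s≤D adm caseIII gap long-side)
... | K₂+s≤d₀ , K₂+s≤d₁ , K₂+s≤d₂ =
  (K₂≤ K₂+s≤d₀ , K₂≤ K₂+s≤d₁ , K₂≤ K₂+s≤d₂) ,
  K₂+s≤δ⇒s≤K₁ (≤-trans K₂+s≤d₀ d₀≤δ) (proj₁ (proj₂ caseIII))
  where
  K₂≤ : ∀ {d} → K₂ + sum xs ≤ d → K₂ ≤ d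
  K₂≤ = ≤-trans (m≤m+n K₂ (sum xs))
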